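{- Let $k\ge3$, $a\in\mathbb{N}$ with $a\ge1$, and $i\in\mathbb{N}$, and set $B=(ki)\oplus(a.k)=(ki+a\,.\,ki+k)$. Then, as formal power series, \[ C_B^{(k)}(y)=y^{a+ki}\,\bigl(H_{k-1}(y)\bigr)^{i+1}\Bigl(y^{k-1}+[a>k]\,G_{k-1}(y)\Bigr). \]
   Context: Words are over the alphabet $\mathbb{N}=\{0,1,2,\dots\}$; $(x.y)$ denotes the length-2 word with letters $x,y$; $n\oplus W$ adds $n$ to every letter of $W$. For $k\ge 2$, $\phi_k$ is the morphism of $\mathbb{N}^*$ defined for $i\in\mathbb{N}$, $0\le j\le k-1$ by $\phi_k(ki+j)=(ki)(ki+j+1)$ if $0\le j\le k-2$ and $\phi_k(ki+k-1)=ki+k$; $W_n^{(k)}=\phi_k^n(0)$. For a nonempty word $B$, $c^{(k)}(B;n)$ is the number of (possibly overlapping) occurrences of $B$ in $W_n^{(k)}$ and $C_B^{(k)}(y)=\sum_{n\ge0}c^{(k)}(B;n)y^n$. $H_{k-1}(y)=1/(1-y-\cdots-y^{k-1})$ as a formal power series. For $m\ge2$, $(g_n^{(m)})$ is defined by $g_0^{(m)}=0$, $g_n^{(m)}=2^{n-1}$ for $1\le n\le m-1$, $g_n^{(m)}=g_{n-1}^{(m)}+\cdots+g_{n-m}^{(m)}$ for $n\ge m$, and $G_m(y)=\sum_n g_n^{(m)}y^n$. $[P]$ is the Iverson bracket. -}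

module Defs where

open import Data.Nat using (ℕ; zero; suc; _+_; _*_; _∸_; _^_; _≤_; _<_; _≟_; _<ᵇ_; _≤ᵇ_; NonZero)
open import Data.Nat.DivMod using (_%_)
open import Data.Bool using (Bool; true; false; if_then_else_; _∧_)
open import Data.List using (List; []; _∷_; concatMap; take; map; upTo; length)
open import Data.Nat.ListAction using (sum)
open import Relation.Nullary.Decidable using (⌊_⌋)

Word : Set
Word = List ℕ

-- The morphism φ_k on a single letter x = k*i + j (0 ≤ j ≤ k-1):
--   j ≤ k-2 : φ_k(x) = (k i)(k i + j + 1) = (x ∸ j)(x + 1)
--   j = k-1 : φ_k(x) = k i + k = x + 1
-- (k = 0 is never used; it is given an arbitrary value to keep the function total.)
φletter : ℕ → ℕ → Word
φletter zero x = x ∷ []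
φletter (suc m) x with x % suc m
... | j = if j <ᵇ m then (x ∸ j) ∷ suc x ∷ [] else suc x ∷ []

φ : (k : ℕ) → Word → Word
φ k w = concatMap (φletter k) w

W : (k : ℕ) → ℕ → Word
W k zero = 0 ∷ []
W k (suc n) = φ k (W k n)

isPrefix : Word → Word → Bool
isPrefix [] _ = true
isPrefix (_ ∷ _) [] = false
isPrefix (b ∷ bs) (x ∷ xs) = ⌊ b ≟ x ⌋ ∧ isPrefix bs xs

occ : Word → Word → ℕ
occ B [] = if isPrefix B [] then 1 else 0
occ B (x ∷ xs) = (if isPrefix B (x ∷ xs) then 1 else 0) + occ B xs

c : (k : ℕ) → Word → ℕ → ℕ
c k B n = occ B (W k n)

-- Formal power series with natural coefficients: coefficient sequences
PS : Set
PS = ℕ → ℕ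

_⊛_ : PS → PS → PS
(f ⊛ g) n = sum (map (λ j → f j * g (n ∸ j)) (upTo (suc n)))

one : PS
one zero = 1
one (suc _) = 0

_^ₛ_ : PS → ℕ → PS
f ^ₛ zero = one
f ^ₛ suc e = f ⊛ (f ^ₛ e)

mono : ℕ → PS
mono m n = if ⌊ m ≟ n ⌋ then 1 else 0

_⊕ₛ_ : PS → PS → PS
(f ⊕ₛ g) n = f n + g n

zeroₛ : PS
zeroₛ _ = 0

-- H_{k-1}(y) = 1/(1 - y - ... - y^{k-1}): its coefficients h_n are the unique
-- solution of h_0 = 1, h_n = h_{n-1} + ... + h_{n-(k-1)} (terms with negative index omitted).
-- hs k n = [h_n, h_{n-1}, ..., h_0]
hs : ℕ → ℕ → List ℕ
hs k zero = 1 ∷ []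
hs k (suc n) = sum (take (k ∸ 1) (hs k n)) ∷ hs k n

headOr0 : List ℕ → ℕ
headOr0 [] = 0
headOr0 (x ∷ _) = x

H : ℕ → PS   -- H k = H_{k-1}
H k n = headOr0 (hs k n)

-- g^{(m)}: g_0 = 0, g_n = 2^{n-1} for 1 ≤ n ≤ m-1, g_n = g_{n-1}+...+g_{n-m} for n ≥ m.
-- gs m n = [g_n, ..., g_0]
gs : ℕ → ℕ → List ℕ
gs m zero = 0 ∷ []
gs m (suc n) = (if suc n <ᵇ m then 2 ^ n else sum (take m (gs m n))) ∷ gs m n

G : ℕ → PS
G m n = headOr0 (gs m n)

iverson>ₛ : ℕ → ℕ → PS → PS
iverson>ₛ a k f = if k <ᵇ a then f else zeroₛ

{-# OPTIONS --safe #-}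
-- Write U_j(n) = φ_kⁿ(j).  As φ_k(j) = 0 (j+1) for j < k - 1, φ_k(k - 1) = k, and φ_k commutes with
-- adding k to every letter, U_j(n+1) = U_0(n) U_{j+1}(n) for j < k - 1 and U_{k-1}(n+1) = k ⊕ U_0(n).
-- So W_n = U_0(n-1) ⋯ U_0(n-k+1) (k ⊕ U_0(n-k)), and for a two-letter word B the counts satisfy
-- c(B;n) = c(B;n-1) + ⋯ + c(B;n-k+1) + r_n, where r_n counts B inside the shifted factor and across
-- the seams.  The seam after U_0(n-e) is the pair (n-e, x) with x = 0 or k (or x = e when n = e).
-- The recurrence says C_B = H_{k-1} R, so it determines C_B.  For B = (a, k) the seams contribute
-- y^{a+k-1}, and the shifted factor contributes the occurrences of (a-k, 0): none if a ≤ k, and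
-- otherwise those come only from seams with x = 0, which yields y^{a-k} G_{k-1}.  For B = k ⊕ B′
-- no seam contributes and the shifted factor gives y^k C_{B′}, whence the induction on i.
module Submission where

open import Defs
open import Data.Bool using (true; false; if_then_else_; _∧_; T)
open import Data.List using (List; []; _∷_; _++_; _∷ʳ_; map; take; upTo)
open import Data.List.Properties using (map-cong; map-applyUpTo; map-upTo; concatMap-++; map-++; ++-assoc)
open import Data.Nat using (ℕ; zero; suc; _+_; _*_; _∸_; _^_; _≤_; _<_; _≟_; _<ᵇ_; _≤?_; z≤n; s≤s; z<s)
open import Data.Nat.DivMod using (_%_; m<n⇒m%n≡m; [m+n]%n≡m%n; m%n≤m)
open import Data.Nat.Induction using (<-rec)
open import Data.Nat.ListAction using (sum)
open import Data.Nat.Solver using (module +-*-Solver)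
open import Data.Nat.Properties
open import Data.Product using (∃-syntax; _,_)
open import Data.Sum using (inj₁; inj₂)
open import Data.Unit using (tt)
open import Function using (_∘_)
open import Relation.Binary.PropositionalEquality
open import Relation.Nullary using (yes; no; contradiction)
open import Relation.Nullary.Decidable using (⌊_⌋)
open import Algebra.Properties.CommutativeSemigroup +-commutativeSemigroup using (interchange)
open ≡-Reasoning

shift : ℕ → PS → PS
shift zero    f n       = f n
shift (suc s) f zero    = 0
shift (suc s) f (suc n) = shift s f n

⊛-zero : ∀ f g → (f ⊛ g) 0 ≡ f 0 * g 0
⊛-zero f g = +-identityʳ (f 0 * g 0)

⊛-suc : ∀ f g n → (f ⊛ g) (suc n) ≡ f 0 * g (suc n) + ((f ∘ suc) ⊛ g) n
⊛-suc f g n = cong (f 0 * g (suc n) +_) (cong sum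
  (trans (map-applyUpTo suc h (suc n)) (sym (map-upTo (h ∘ suc) (suc n)))))
  where h = λ j → f j * g (suc n ∸ j)

⊛-congˡ : ∀ {f f′} g → f ≗ f′ → (f ⊛ g) ≗ (f′ ⊛ g)
⊛-congˡ g f≗f′ n = cong sum (map-cong (λ j → cong (_* g (n ∸ j)) (f≗f′ j)) (upTo (suc n)))

⊛-zeroˡ : ∀ g → (zeroₛ ⊛ g) ≗ zeroₛ
⊛-zeroˡ g zero    = refl
⊛-zeroˡ g (suc n) = trans (⊛-suc zeroₛ g n) (⊛-zeroˡ g n)

⊛-identityˡ : ∀ g → (one ⊛ g) ≗ g
⊛-identityˡ g zero    = trans (⊛-zero one g) (*-identityˡ (g 0))
⊛-identityˡ g (suc n) = begin
  (one ⊛ g) (suc n)              ≡⟨ ⊛-suc one g n ⟩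
  1 * g (suc n) + (zeroₛ ⊛ g) n  ≡⟨ cong₂ _+_ (*-identityˡ (g (suc n))) (⊛-zeroˡ g n) ⟩
  g (suc n) + 0                  ≡⟨ +-identityʳ (g (suc n)) ⟩
  g (suc n)                      ∎

⊛-distribʳ-⊕ : ∀ f g h → ((f ⊕ₛ g) ⊛ h) ≗ ((f ⊛ h) ⊕ₛ (g ⊛ h))
⊛-distribʳ-⊕ f g h zero = begin
  ((f ⊕ₛ g) ⊛ h) 0           ≡⟨ ⊛-zero (f ⊕ₛ g) h ⟩
  (f 0 + g 0) * h 0          ≡⟨ *-distribʳ-+ (h 0) (f 0) (g 0) ⟩
  f 0 * h 0 + g 0 * h 0      ≡⟨ cong₂ _+_ (⊛-zero f h) (⊛-zero g h) ⟨
  (f ⊛ h) 0 + (g ⊛ h) 0      ∎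
⊛-distribʳ-⊕ f g h (suc n) = begin
  ((f ⊕ₛ g) ⊛ h) (suc n)
    ≡⟨ ⊛-suc (f ⊕ₛ g) h n ⟩
  (f 0 + g 0) * h (suc n) + (((f ∘ suc) ⊕ₛ (g ∘ suc)) ⊛ h) n
    ≡⟨ cong₂ _+_ (*-distribʳ-+ (h (suc n)) (f 0) (g 0)) (⊛-distribʳ-⊕ (f ∘ suc) (g ∘ suc) h n) ⟩
  (f 0 * h (suc n) + g 0 * h (suc n)) + (((f ∘ suc) ⊛ h) n + ((g ∘ suc) ⊛ h) n)
    ≡⟨ interchange (f 0 * h (suc n)) _ _ _ ⟩
  (f 0 * h (suc n) + ((f ∘ suc) ⊛ h) n) + (g 0 * h (suc n) + ((g ∘ suc) ⊛ h) n)
    ≡⟨ cong₂ _+_ (⊛-suc f h n) (⊛-suc g h n) ⟨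
  (f ⊛ h) (suc n) + (g ⊛ h) (suc n)
    ∎

shift-cong : ∀ s {f g} → f ≗ g → shift s f ≗ shift s g
shift-cong zero    f≗g n       = f≗g n
shift-cong (suc s) f≗g zero    = refl
shift-cong (suc s) f≗g (suc n) = shift-cong s f≗g n

shift-suc : ∀ s f → shift (suc s) f ≗ shift 1 (shift s f)
shift-suc s f zero    = refl
shift-suc s f (suc n) = refl

shift-+ : ∀ s s′ f → shift (s + s′) f ≗ shift s (shift s′ f)
shift-+ zero    s′ f n       = refl
shift-+ (suc s) s′ f zero    = refl
shift-+ (suc s) s′ f (suc n) = shift-+ s s′ f n

shift-⊕ : ∀ s f g → shift s (f ⊕ₛ g) ≗ (shift s f ⊕ₛ shift s g)
shift-⊕ zero    f g n       = refl
shift-⊕ (suc s) f g zero    = refl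
shift-⊕ (suc s) f g (suc n) = shift-⊕ s f g n

shift-zeroₛ : ∀ s → shift s zeroₛ ≗ zeroₛ
shift-zeroₛ zero    n       = refl
shift-zeroₛ (suc s) zero    = refl
shift-zeroₛ (suc s) (suc n) = shift-zeroₛ s n

shift-⊛ : ∀ s f g → (shift s f ⊛ g) ≗ shift s (f ⊛ g)
shift-⊛ zero    f g n       = refl
shift-⊛ (suc s) f g zero    = refl
shift-⊛ (suc s) f g (suc n) = trans (⊛-suc (shift (suc s) f) g n) (shift-⊛ s f g n)

mono-diag : ∀ n → mono n n ≡ 1
mono-diag n with n ≟ n
... | yes _   = refl
... | no n≢n = contradiction refl n≢n

mono-≢ : ∀ {m n} → m ≢ n → mono m n ≡ 0
mono-≢ {m} {n} m≢n with m ≟ n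
... | yes m≡n = contradiction m≡n m≢n
... | no _    = refl

mono-suc : ∀ m n → mono (suc m) (suc n) ≡ mono m n
mono-suc m n with m ≟ n
... | yes refl = mono-diag (suc m)
... | no m≢n   = mono-≢ (m≢n ∘ suc-injective)

shift-mono : ∀ s j → shift s (mono j) ≗ mono (s + j)
shift-mono zero    j n       = refl
shift-mono (suc s) j zero    = refl
shift-mono (suc s) j (suc n) = trans (shift-mono s j n) (sym (mono-suc (s + j) n))

mono≗shift-one : ∀ s → mono s ≗ shift s one
mono≗shift-one zero    zero    = refl
mono≗shift-one zero    (suc n) = refl
mono≗shift-one (suc s) zero    = refl
mono≗shift-one (suc s) (suc n) = trans (mono-suc s n) (mono≗shift-one s n)

mono-⊛ : ∀ s g → (mono s ⊛ g) ≗ shift s g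
mono-⊛ s g n = begin
  (mono s ⊛ g) n         ≡⟨ ⊛-congˡ g (mono≗shift-one s) n ⟩
  (shift s one ⊛ g) n    ≡⟨ shift-⊛ s one g n ⟩
  shift s (one ⊛ g) n    ≡⟨ shift-cong s (⊛-identityˡ g) n ⟩
  shift s g n            ∎

-- lagSum d f n = f (n - 1) + ⋯ + f (n - d), omitting terms of negative index
lagSum : ℕ → PS → PS
lagSum zero    f = zeroₛ
lagSum (suc d) f = shift 1 (f ⊕ₛ lagSum d f)

lagSum-at-0 : ∀ d f → lagSum d f 0 ≡ 0
lagSum-at-0 zero    f = refl
lagSum-at-0 (suc d) f = refl

lagSum-local : ∀ d {f g} n → (∀ {i} → i < n → f i ≡ g i) → lagSum d f n ≡ lagSum d g n
lagSum-local zero    n       f≡g = refl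
lagSum-local (suc d) zero    f≡g = refl
lagSum-local (suc d) (suc n) f≡g = cong₂ _+_ (f≡g ≤-refl) (lagSum-local d n (f≡g ∘ m<n⇒m<1+n))

lagSum-cong : ∀ d {f g} → f ≗ g → lagSum d f ≗ lagSum d g
lagSum-cong d f≗g n = lagSum-local d n (λ {i} _ → f≗g i)

lagSum-zeroₛ : ∀ d → lagSum d zeroₛ ≗ zeroₛ
lagSum-zeroₛ zero    n       = refl
lagSum-zeroₛ (suc d) zero    = refl
lagSum-zeroₛ (suc d) (suc n) = lagSum-zeroₛ d n

lagSum-shift1 : ∀ d f → lagSum d (shift 1 f) ≗ shift 1 (lagSum d f)
lagSum-shift1 zero    f zero          = refl
lagSum-shift1 zero    f (suc n)       = refl
lagSum-shift1 (suc d) f zero          = refl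
lagSum-shift1 (suc d) f (suc zero)    = lagSum-at-0 d (shift 1 f)
lagSum-shift1 (suc d) f (suc (suc n)) = cong (f n +_) (lagSum-shift1 d f (suc n))

lagSum-shift : ∀ d s f → lagSum d (shift s f) ≗ shift s (lagSum d f)
lagSum-shift d zero    f n = refl
lagSum-shift d (suc s) f n = begin
  lagSum d (shift (suc s) f) n            ≡⟨ lagSum-cong d (shift-suc s f) n ⟩
  lagSum d (shift 1 (shift s f)) n        ≡⟨ lagSum-shift1 d (shift s f) n ⟩
  shift 1 (lagSum d (shift s f)) n        ≡⟨ shift-cong 1 (lagSum-shift d s f) n ⟩
  shift 1 (shift s (lagSum d f)) n        ≡⟨ shift-suc s (lagSum d f) n ⟨
  shift (suc s) (lagSum d f) n            ∎

lagSum-⊛ : ∀ d f g → (lagSum d f ⊛ g) ≗ lagSum d (f ⊛ g)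
lagSum-⊛ zero    f g n       = ⊛-zeroˡ g n
lagSum-⊛ (suc d) f g zero    = refl
lagSum-⊛ (suc d) f g (suc n) = begin
  (lagSum (suc d) f ⊛ g) (suc n)             ≡⟨ shift-⊛ 1 (f ⊕ₛ lagSum d f) g (suc n) ⟩
  ((f ⊕ₛ lagSum d f) ⊛ g) n                  ≡⟨ ⊛-distribʳ-⊕ f (lagSum d f) g n ⟩
  (f ⊛ g) n + (lagSum d f ⊛ g) n             ≡⟨ cong ((f ⊛ g) n +_) (lagSum-⊛ d f g n) ⟩
  (f ⊛ g) n + lagSum d (f ⊛ g) n             ∎

lagSum-one : ∀ d n → lagSum d one (suc n) ≡ (if n <ᵇ d then 1 else 0)
lagSum-one zero    n       = refl
lagSum-one (suc d) zero    = cong (1 +_) (lagSum-at-0 d one)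
lagSum-one (suc d) (suc n) = lagSum-one d n

lagSum-saturated : ∀ d f n → n ≤ d → lagSum d f n ≡ lagSum n f n
lagSum-saturated d       f zero    _         = lagSum-at-0 d f
lagSum-saturated (suc d) f (suc n) (s≤s n≤d) = cong (f n +_) (lagSum-saturated d f n n≤d)

-- (1 - y - ⋯ - y^d) x = r
Recurrence : ℕ → PS → PS → Set
Recurrence d x r = x ≗ (lagSum d x ⊕ₛ r)

recurrence-resp : ∀ {d x r r′} → r ≗ r′ → Recurrence d x r → Recurrence d x r′
recurrence-resp {d} {x} r≗r′ rec n = trans (rec n) (cong (lagSum d x n +_) (r≗r′ n))

recurrence-unique : ∀ {d x y r r′} → Recurrence d x r → Recurrence d y r′ → r ≗ r′ → x ≗ y
recurrence-unique {d} {x} {y} {r} {r′} x-rec y-rec r≗r′ = <-rec (λ n → x n ≡ y n) step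
  where
  step : ∀ n → (∀ {i} → i < n → x i ≡ y i) → x n ≡ y n
  step n x≡y-below = begin
    x n                    ≡⟨ x-rec n ⟩
    lagSum d x n + r n     ≡⟨ cong₂ _+_ (lagSum-local d n x≡y-below) (r≗r′ n) ⟩
    lagSum d y n + r′ n    ≡⟨ y-rec n ⟨
    y n                    ∎

recurrence-shift : ∀ {d x r} s → Recurrence d x r → Recurrence d (shift s x) (shift s r)
recurrence-shift {d} {x} {r} s rec n = begin
  shift s x n                                ≡⟨ shift-cong s rec n ⟩
  shift s (lagSum d x ⊕ₛ r) n                ≡⟨ shift-⊕ s (lagSum d x) r n ⟩
  shift s (lagSum d x) n + shift s r n       ≡⟨ cong (_+ shift s r n) (lagSum-shift d s x n) ⟨
  lagSum d (shift s x) n + shift s r n       ∎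

recurrence-⊛ : ∀ {d x r} g → Recurrence d x r → Recurrence d (x ⊛ g) (r ⊛ g)
recurrence-⊛ {d} {x} {r} g rec n = begin
  (x ⊛ g) n                                  ≡⟨ ⊛-congˡ g rec n ⟩
  ((lagSum d x ⊕ₛ r) ⊛ g) n                  ≡⟨ ⊛-distribʳ-⊕ (lagSum d x) r g n ⟩
  (lagSum d x ⊛ g) n + (r ⊛ g) n             ≡⟨ cong (_+ (r ⊛ g) n) (lagSum-⊛ d x g n) ⟩
  lagSum d (x ⊛ g) n + (r ⊛ g) n             ∎

history : PS → ℕ → List ℕ
history f zero    = f 0 ∷ []
history f (suc n) = f (suc n) ∷ history f n

sum-take-history : ∀ d f n → sum (take d (history f n)) ≡ lagSum d f (suc n)
sum-take-history zero          f n       = refl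
sum-take-history (suc zero)    f zero    = refl
sum-take-history (suc (suc d)) f zero    = refl
sum-take-history (suc d)       f (suc n) = cong (f (suc n) +_) (sum-take-history d f n)

hs≡history : ∀ k n → hs k n ≡ history (H k) n
hs≡history k zero    = refl
hs≡history k (suc n) = cong (H k (suc n) ∷_) (hs≡history k n)

gs≡history : ∀ m n → gs m n ≡ history (G m) n
gs≡history m zero    = refl
gs≡history m (suc n) = cong (G m (suc n) ∷_) (gs≡history m n)

recurrence-H : ∀ k → Recurrence (k ∸ 1) (H k) one
recurrence-H k zero    = sym (cong (_+ 1) (lagSum-at-0 (k ∸ 1) (H k)))
recurrence-H k (suc n) = begin
  sum (take (k ∸ 1) (hs k n))                  ≡⟨ cong (sum ∘ take (k ∸ 1)) (hs≡history k n) ⟩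
  sum (take (k ∸ 1) (history (H k) n))         ≡⟨ sum-take-history (k ∸ 1) (H k) n ⟩
  lagSum (k ∸ 1) (H k) (suc n)                 ≡⟨ +-identityʳ _ ⟨
  lagSum (k ∸ 1) (H k) (suc n) + 0             ∎

recurrence-H-power : ∀ k i → Recurrence (k ∸ 1) (H k ^ₛ suc i) (H k ^ₛ i)
recurrence-H-power k i =
  recurrence-resp {k ∸ 1} (⊛-identityˡ (H k ^ₛ i))
    (recurrence-⊛ {k ∸ 1} (H k ^ₛ i) (recurrence-H k))

G-below : ∀ d n → n < d → G (suc d) (suc n) ≡ 2 ^ n
G-below d n n<d with n <ᵇ d | <⇒<ᵇ n<d
... | true | _ = refl

G-partial-sum : ∀ d n → n ≤ d → lagSum (suc n) (G (suc d)) (suc n) + 1 ≡ 2 ^ n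
G-partial-sum d zero    _   = refl
G-partial-sum d (suc n) n<d = begin
  G (suc d) (suc n) + lagSum (suc n) (G (suc d)) (suc n) + 1
    ≡⟨ +-assoc (G (suc d) (suc n)) _ 1 ⟩
  G (suc d) (suc n) + (lagSum (suc n) (G (suc d)) (suc n) + 1)
    ≡⟨ cong₂ _+_ (G-below d n n<d) (G-partial-sum d n (<⇒≤ n<d)) ⟩
  2 ^ n + 2 ^ n
    ≡⟨ cong (2 ^ n +_) (+-identityʳ (2 ^ n)) ⟨
  2 ^ suc n
    ∎

recurrence-G : ∀ d → Recurrence (suc d) (G (suc d)) (lagSum d one)
recurrence-G d zero    = sym (lagSum-at-0 d one)
recurrence-G d (suc n) = begin
  G (suc d) (suc n)
    ≡⟨ cong (λ l → if n <ᵇ d then 2 ^ n else sum (take (suc d) l)) (gs≡history (suc d) n) ⟩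
  (if n <ᵇ d then 2 ^ n else sum (take (suc d) (history g n)))
    ≡⟨ cong (λ s → if n <ᵇ d then 2 ^ n else s) (sum-take-history (suc d) g n) ⟩
  (if n <ᵇ d then 2 ^ n else lagSum (suc d) g (suc n))
    ≡⟨ by-cases (n <ᵇ d) refl ⟩
  lagSum (suc d) g (suc n) + (if n <ᵇ d then 1 else 0)
    ≡⟨ cong (lagSum (suc d) g (suc n) +_) (lagSum-one d n) ⟨
  lagSum (suc d) g (suc n) + lagSum d one (suc n)
    ∎
  where
  g = G (suc d)
  by-cases : ∀ b → (n <ᵇ d) ≡ b →
    (if b then 2 ^ n else lagSum (suc d) g (suc n)) ≡ lagSum (suc d) g (suc n) + (if b then 1 else 0)
  by-cases true  n<ᵇd = begin
    2 ^ n
      ≡⟨ G-partial-sum d n (<⇒≤ n<d) ⟨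
    lagSum (suc n) g (suc n) + 1
      ≡⟨ cong (_+ 1) (lagSum-saturated (suc d) g (suc n) (m≤n⇒m≤1+n n<d)) ⟨
    lagSum (suc d) g (suc n) + 1
      ∎
    where n<d = <ᵇ⇒< n d (subst T (sym n<ᵇd) tt)
  by-cases false _ = sym (+-identityʳ _)

iverson>-true : ∀ {a b} f → b < a → iverson>ₛ a b f ≡ f
iverson>-true {a} {b} f b<a with b <ᵇ a | <⇒<ᵇ b<a
... | true | _ = refl

iverson>-false : ∀ {a b} f → a ≤ b → iverson>ₛ a b f ≡ zeroₛ
iverson>-false {a} {b} f a≤b with b <ᵇ a in b<ᵇa
... | false = refl
... | true  = contradiction (<ᵇ⇒< b a (subst T (sym b<ᵇa) tt)) (≤⇒≯ a≤b)

⌊+≟+⌋ : ∀ K b x → ⌊ K + b ≟ K + x ⌋ ≡ ⌊ b ≟ x ⌋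
⌊+≟+⌋ K b x with b ≟ x | K + b ≟ K + x
... | yes _    | yes _     = refl
... | no _     | no _      = refl
... | yes refl | no K+b≢K+b = contradiction refl K+b≢K+b
... | no b≢x   | yes K+b≡K+x = contradiction (+-cancelˡ-≡ K b x K+b≡K+x) b≢x

isPrefix-map-+ : ∀ K B w → isPrefix (map (K +_) B) (map (K +_) w) ≡ isPrefix B w
isPrefix-map-+ K []      w       = refl
isPrefix-map-+ K (b ∷ B) []      = refl
isPrefix-map-+ K (b ∷ B) (x ∷ w) = cong₂ _∧_ (⌊+≟+⌋ K b x) (isPrefix-map-+ K B w)

occ-map-+ : ∀ K B w → occ (map (K +_) B) (map (K +_) w) ≡ occ B w
occ-map-+ K B []      = cong (λ b → if b then 1 else 0) (isPrefix-map-+ K B [])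
occ-map-+ K B (x ∷ w) =
  cong₂ _+_ (cong (λ b → if b then 1 else 0) (isPrefix-map-+ K B (x ∷ w))) (occ-map-+ K B w)

module Pattern (p q : ℕ) where

  B : Word
  B = p ∷ q ∷ []

  hit : ℕ → ℕ → ℕ
  hit u v = if isPrefix B (u ∷ v ∷ []) then 1 else 0

  hit≡mono*mono : ∀ u v → hit u v ≡ mono p u * mono q v
  hit≡mono*mono u v with p ≟ u | q ≟ v
  ... | yes _ | yes _ = refl
  ... | yes _ | no _  = refl
  ... | no _  | _     = refl

  occ-singleton : ∀ u → occ B (u ∷ []) ≡ 0
  occ-singleton u with p ≟ u
  ... | yes _ = refl
  ... | no _  = refl

  private
    +-cons : ∀ h {l a b c} → l ≡ a + b + c → h + l ≡ h + a + b + c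
    +-cons h {l} {a} {b} {c} l≡a+b+c = begin
      h + l              ≡⟨ cong (h +_) l≡a+b+c ⟩
      h + (a + b + c)    ≡⟨ cong (h +_) (+-assoc a b c) ⟩
      h + (a + (b + c))  ≡⟨ +-assoc h a (b + c) ⟨
      h + a + (b + c)    ≡⟨ +-assoc (h + a) b c ⟨
      h + a + b + c      ∎

  occ-++ : ∀ {w₁ w₂ u v} → ∃[ xs ] w₁ ≡ xs ∷ʳ u → ∃[ ys ] w₂ ≡ v ∷ ys →
           occ B (w₁ ++ w₂) ≡ occ B w₁ + occ B w₂ + hit u v
  occ-++ {u = u} {v} ([] , refl) (ys , refl) = begin
    hit u v + occ B (v ∷ ys)                    ≡⟨ +-comm (hit u v) _ ⟩
    occ B (v ∷ ys) + hit u v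
      ≡⟨ cong (λ z → z + occ B (v ∷ ys) + hit u v) (occ-singleton u) ⟨
    occ B (u ∷ []) + occ B (v ∷ ys) + hit u v   ∎
  occ-++ {u = u} (x ∷ [] , refl) w₂-starts = +-cons (hit x u) (occ-++ ([] , refl) w₂-starts)
  occ-++ (x ∷ y ∷ xs , refl)     w₂-starts = +-cons (hit x y) (occ-++ (y ∷ xs , refl) w₂-starts)

  occ-map-+-≡0 : ∀ K → (∀ u v → hit (K + u) (K + v) ≡ 0) → ∀ w → occ B (map (K +_) w) ≡ 0
  occ-map-+-≡0 K no-hit []          = refl
  occ-map-+-≡0 K no-hit (u ∷ [])    = occ-singleton (K + u)
  occ-map-+-≡0 K no-hit (u ∷ v ∷ w) = cong₂ _+_ (no-hit u v) (occ-map-+-≡0 K no-hit (v ∷ w))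

-- All of the following holds for every k = m + 2 ≥ 2; t = k - 1 is the letter with φ_k(t) = k.
module _ (m : ℕ) where

  private
    t k : ℕ
    t = suc m
    k = suc t

  φ^ : ℕ → Word → Word
  φ^ zero    w = w
  φ^ (suc n) w = φ k (φ^ n w)

  word : ℕ → ℕ → Word
  word j n = φ^ n (j ∷ [])

  W≡word0 : ∀ n → W k n ≡ word 0 n
  W≡word0 zero    = refl
  W≡word0 (suc n) = cong (φ k) (W≡word0 n)

  φ^-suc : ∀ n w → φ^ (suc n) w ≡ φ^ n (φ k w)
  φ^-suc zero    w = refl
  φ^-suc (suc n) w = cong (φ k) (φ^-suc n w)

  φ^-++ : ∀ n xs ys → φ^ n (xs ++ ys) ≡ φ^ n xs ++ φ^ n ys
  φ^-++ zero    xs ys = refl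
  φ^-++ (suc n) xs ys =
    trans (cong (φ k) (φ^-++ n xs ys)) (concatMap-++ (φletter k) (φ^ n xs) (φ^ n ys))

  φletter-+k : ∀ x → φletter k (k + x) ≡ map (k +_) (φletter k x)
  φletter-+k x rewrite trans (cong (_% k) (+-comm k x)) ([m+n]%n≡m%n x k) with x % k <ᵇ t
  ... | true  = cong₂ _∷_ (+-∸-assoc k (m%n≤m x k)) (cong (_∷ []) (sym (+-suc k x)))
  ... | false = cong (_∷ []) (sym (+-suc k x))

  φ-map-+k : ∀ w → φ k (map (k +_) w) ≡ map (k +_) (φ k w)
  φ-map-+k []      = refl
  φ-map-+k (x ∷ w) =
    trans (cong₂ _++_ (φletter-+k x) (φ-map-+k w)) (sym (map-++ (k +_) (φletter k x) (φ k w)))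

  φ^-map-+k : ∀ n w → φ^ n (map (k +_) w) ≡ map (k +_) (φ^ n w)
  φ^-map-+k zero    w = refl
  φ^-map-+k (suc n) w = trans (cong (φ k) (φ^-map-+k n w)) (φ-map-+k (φ^ n w))

  φ-below : ∀ {j} → j < t → φ k (j ∷ []) ≡ 0 ∷ suc j ∷ []
  φ-below {j} j<t rewrite m<n⇒m%n≡m {n = k} (m<n⇒m<1+n j<t) with j <ᵇ t | <⇒<ᵇ j<t
  ... | true | _ = cong (_∷ suc j ∷ []) (n∸n≡0 j)

  φ-top : φ k (t ∷ []) ≡ k ∷ []
  φ-top rewrite m<n⇒m%n≡m {n = k} (n<1+n t) with t <ᵇ t in t<ᵇt
  ... | false = refl
  ... | true  = contradiction (<ᵇ⇒< t t (subst T (sym t<ᵇt) tt)) (<-irrefl refl)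

  word-below : ∀ {j} n → j < t → word j (suc n) ≡ word 0 n ++ word (suc j) n
  word-below {j} n j<t = begin
    φ^ (suc n) (j ∷ [])          ≡⟨ φ^-suc n (j ∷ []) ⟩
    φ^ n (φ k (j ∷ []))          ≡⟨ cong (φ^ n) (φ-below j<t) ⟩
    φ^ n (0 ∷ suc j ∷ [])        ≡⟨ φ^-++ n (0 ∷ []) (suc j ∷ []) ⟩
    word 0 n ++ word (suc j) n   ∎

  word-top : ∀ n → word t (suc n) ≡ map (k +_) (word 0 n)
  word-top n = begin
    φ^ (suc n) (t ∷ [])          ≡⟨ φ^-suc n (t ∷ []) ⟩
    φ^ n (φ k (t ∷ []))          ≡⟨ cong (φ^ n) (trans φ-top (cong (_∷ []) (sym (+-identityʳ k)))) ⟩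
    φ^ n (map (k +_) (0 ∷ []))   ≡⟨ φ^-map-+k n (0 ∷ []) ⟩
    map (k +_) (word 0 n)        ∎

  word-below-∸ : ∀ {d} n → d < t → word (t ∸ suc d) (suc n) ≡ word 0 n ++ word (t ∸ d) n
  word-below-∸ {d} n (s≤s d≤m) =
    trans (word-below n (s≤s (m∸n≤m m d)))
          (cong (λ j → word 0 n ++ word j n) (sym (+-∸-assoc 1 d≤m)))

  word0-starts : ∀ n → ∃[ ys ] word 0 n ≡ 0 ∷ ys
  word0-starts zero    = [] , refl
  word0-starts (suc n) with word0-starts n
  ... | ys , eq = ys ++ word 1 n , trans (word-below n z<s) (cong (_++ word 1 n) eq)

  -- the first letter of word (t ∸ d) n
  start : ℕ → ℕ → ℕ
  start d       zero    = t ∸ d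
  start zero    (suc n) = k
  start (suc d) (suc n) = 0

  word-starts : ∀ d n → ∃[ ys ] word (t ∸ d) n ≡ start d n ∷ ys
  word-starts d       zero    = [] , refl
  word-starts zero    (suc n) with word0-starts n
  ... | ys , eq = map (k +_) ys ,
        trans (word-top n) (trans (cong (map (k +_)) eq) (cong (_∷ map (k +_) ys) (+-identityʳ k)))
  word-starts (suc d) (suc n) with word0-starts n
  ... | ys , eq = ys ++ word (suc (m ∸ d)) n ,
        trans (word-below n (s≤s (m∸n≤m m d))) (cong (_++ word (suc (m ∸ d)) n) eq)

  word-ends : ∀ {j} n → j ≤ t → ∃[ xs ] word j n ≡ xs ∷ʳ (j + n)
  word-ends {j} zero _ = [] , cong (_∷ []) (sym (+-identityʳ j))
  word-ends {j} (suc n) j≤t with m≤n⇒m<n∨m≡n j≤t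
  ... | inj₁ j<t with word-ends n j<t
  ...   | xs , eq = word 0 n ++ xs , (begin
          word j (suc n)                     ≡⟨ word-below n j<t ⟩
          word 0 n ++ word (suc j) n         ≡⟨ cong (word 0 n ++_) eq ⟩
          word 0 n ++ (xs ∷ʳ (suc j + n))    ≡⟨ ++-assoc (word 0 n) xs _ ⟨
          (word 0 n ++ xs) ∷ʳ (suc j + n)    ≡⟨ cong ((word 0 n ++ xs) ∷ʳ_) (+-suc j n) ⟨
          (word 0 n ++ xs) ∷ʳ (j + suc n)    ∎)
  word-ends {j} (suc n) j≤t | inj₂ refl with word-ends n z≤n
  ...   | xs , eq = map (k +_) xs , (begin
          word t (suc n)                     ≡⟨ word-top n ⟩
          map (k +_) (word 0 n)              ≡⟨ cong (map (k +_)) eq ⟩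
          map (k +_) (xs ∷ʳ n)               ≡⟨ map-++ (k +_) xs (n ∷ []) ⟩
          map (k +_) xs ∷ʳ (k + n)           ≡⟨ cong (map (k +_) xs ∷ʳ_) (+-suc t n) ⟨
          map (k +_) xs ∷ʳ (t + suc n)       ∎)

  module Count (p q : ℕ) where
    open Pattern p q public

    count : PS
    count n = occ B (word 0 n)

    count-shifted : PS
    count-shifted n = occ B (map (k +_) (word 0 n))

    -- Occurrences across the seams of word (t ∸ d) n = word 0 (n-1) ⋯ word 0 (n-d) word t (n-d);
    -- the seam after word 0 (n-e) is the pair (n-e, start (d-e) (n-e)).
    junction : ℕ → PS
    junction zero    = zeroₛ
    junction (suc d) = shift 1 ((λ n → hit n (start d n)) ⊕ₛ junction d)

    occ-word : ∀ d → d ≤ t → ∀ n →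
      occ B (word (t ∸ d) n) ≡ lagSum d count n + shift (suc d) count-shifted n + junction d n
    occ-word zero    _   zero    = occ-singleton t
    occ-word zero    _   (suc n) = trans (cong (occ B) (word-top n)) (sym (+-identityʳ _))
    occ-word (suc d) _   zero    = occ-singleton (m ∸ d)
    occ-word (suc d) d<t (suc n) = begin
      occ B (word (t ∸ suc d) (suc n))
        ≡⟨ cong (occ B) (word-below-∸ n d<t) ⟩
      occ B (word 0 n ++ word (t ∸ d) n)
        ≡⟨ occ-++ (word-ends n z≤n) (word-starts d n) ⟩
      count n + occ B (word (t ∸ d) n) + hit n (start d n)
        ≡⟨ cong (λ z → count n + z + hit n (start d n)) (occ-word d (<⇒≤ d<t) n) ⟩
      count n + (lagSum d count n + shift (suc d) count-shifted n + junction d n) + hit n (start d n)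
        ≡⟨ solve 5 (λ a b c e h → a :+ (b :+ c :+ e) :+ h := a :+ b :+ c :+ (h :+ e)) refl
             (count n) (lagSum d count n) (shift (suc d) count-shifted n)
             (junction d n) (hit n (start d n)) ⟩
      count n + lagSum d count n + shift (suc d) count-shifted n + (hit n (start d n) + junction d n)
        ∎
      where open +-*-Solver

    recurrence-count : Recurrence t count (shift k count-shifted ⊕ₛ junction t)
    recurrence-count n = begin
      count n                                                     ≡⟨ cong (λ j → occ B (word j n)) (n∸n≡0 t) ⟨
      occ B (word (t ∸ t) n)                                      ≡⟨ occ-word t ≤-refl n ⟩
      lagSum t count n + shift k count-shifted n + junction t n   ≡⟨ +-assoc (lagSum t count n) _ _ ⟩
      lagSum t count n + (shift k count-shifted n + junction t n) ∎

    junction-≡0 : ∀ d → (∀ {δ} → δ < d → ∀ n → hit n (start δ n) ≡ 0) → junction d ≗ zeroₛ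
    junction-≡0 zero    _      n       = refl
    junction-≡0 (suc d) no-hit zero    = refl
    junction-≡0 (suc d) no-hit (suc n) =
      cong₂ _+_ (no-hit ≤-refl n) (junction-≡0 d (no-hit ∘ m<n⇒m<1+n) n)

    junction-top : 1 ≤ p → q ≡ k → ∀ d → junction (suc d) ≗ mono (suc d + p)
    junction-top (s≤s z≤n) refl d       zero    = refl
    junction-top (s≤s z≤n) refl zero    (suc n) = begin
      hit n (start 0 n) + 0   ≡⟨ +-identityʳ _ ⟩
      hit n (start 0 n)       ≡⟨ hit-top n ⟩
      mono p n                ≡⟨ mono-suc p n ⟨
      mono (suc p) (suc n)    ∎
      where
      hit-top : ∀ n → hit n (start 0 n) ≡ mono p n
      hit-top zero    = hit≡mono*mono 0 t
      hit-top (suc n) = begin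
        hit (suc n) k                  ≡⟨ hit≡mono*mono (suc n) k ⟩
        mono p (suc n) * mono k k      ≡⟨ cong (mono p (suc n) *_) (mono-diag k) ⟩
        mono p (suc n) * 1             ≡⟨ *-identityʳ _ ⟩
        mono p (suc n)                 ∎
    junction-top p≥1@(s≤s z≤n) refl (suc d) (suc n) = begin
      hit n (start (suc d) n) + junction (suc d) n   ≡⟨ cong₂ _+_ (hit-below n) (junction-top p≥1 refl d n) ⟩
      mono (suc d + p) n                             ≡⟨ mono-suc (suc d + p) n ⟨
      mono (suc (suc d) + p) (suc n)                 ∎
      where
      hit-below : ∀ n → hit n (start (suc d) n) ≡ 0
      hit-below zero    = hit≡mono*mono 0 (t ∸ suc d)
      hit-below (suc n) = trans (hit≡mono*mono (suc n) 0) (*-zeroʳ (mono p (suc n)))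

    junction-bottom : 1 ≤ p → q ≡ 0 → ∀ d → junction (suc d) ≗ lagSum d (mono p)
    junction-bottom (s≤s z≤n) refl d       zero    = sym (lagSum-at-0 d (mono p))
    junction-bottom (s≤s z≤n) refl zero    (suc n) = trans (+-identityʳ _) (hit-top n)
      where
      hit-top : ∀ n → hit n (start 0 n) ≡ 0
      hit-top zero    = hit≡mono*mono 0 t
      hit-top (suc n) = trans (hit≡mono*mono (suc n) k) (*-zeroʳ (mono p (suc n)))
    junction-bottom p≥1@(s≤s z≤n) refl (suc d) (suc n) =
      cong₂ _+_ (hit-below n) (junction-bottom p≥1 refl d n)
      where
      hit-below : ∀ n → hit n (start (suc d) n) ≡ mono p n
      hit-below zero    = hit≡mono*mono 0 (t ∸ suc d)
      hit-below (suc n) = trans (hit≡mono*mono (suc n) 0) (*-identityʳ (mono p (suc n)))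

  count-shifted-+ : ∀ p q → Count.count-shifted (k + p) (k + q) ≗ Count.count p q
  count-shifted-+ p q n = occ-map-+ k (p ∷ q ∷ []) (word 0 n)

  count[0,0]≗0 : Count.count 0 0 ≗ zeroₛ
  count[0,0]≗0 = recurrence-unique {t} recurrence-count zero-recurrence forcing≗0
    where
    open Count 0 0
    zero-recurrence : Recurrence t zeroₛ zeroₛ
    zero-recurrence n = sym (trans (+-identityʳ _) (lagSum-zeroₛ t n))
    no-hit : ∀ {δ} → δ < t → ∀ n → hit n (start δ n) ≡ 0
    no-hit {δ} δ<t zero    = begin
      hit 0 (t ∸ δ)                ≡⟨ hit≡mono*mono 0 (t ∸ δ) ⟩
      1 * mono 0 (t ∸ δ)           ≡⟨ *-identityˡ _ ⟩
      mono 0 (t ∸ δ)               ≡⟨ mono-≢ (<⇒≢ (m<n⇒0<n∸m δ<t)) ⟩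
      0                            ∎
    no-hit {δ} δ<t (suc n) = hit≡mono*mono (suc n) (start δ (suc n))
    shifted≗0 : count-shifted ≗ zeroₛ
    shifted≗0 n = occ-map-+-≡0 k (λ u v → hit≡mono*mono (k + u) (k + v)) (word 0 n)
    forcing≗0 : (shift k count-shifted ⊕ₛ junction t) ≗ zeroₛ
    forcing≗0 n =
      cong₂ _+_ (trans (shift-cong k shifted≗0 n) (shift-zeroₛ k n)) (junction-≡0 t no-hit n)

  count[1+b,0] : ∀ b → Count.count (suc b) 0 ≗ shift (suc b) (G t)
  count[1+b,0] b =
    recurrence-unique {t} recurrence-count (recurrence-shift {t} (suc b) (recurrence-G m)) forcing
    where
    open Count (suc b) 0
    no-hit : ∀ u v → hit (k + u) (k + v) ≡ 0
    no-hit u v = trans (hit≡mono*mono (k + u) (k + v)) (*-zeroʳ (mono (suc b) (k + u)))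
    forcing : (shift k count-shifted ⊕ₛ junction t) ≗ shift (suc b) (lagSum m one)
    forcing n = begin
      shift k count-shifted n + junction t n
        ≡⟨ cong₂ _+_ (shift-cong k (λ n → occ-map-+-≡0 k no-hit (word 0 n)) n)
                     (junction-bottom (s≤s z≤n) refl m n) ⟩
      shift k zeroₛ n + lagSum m (mono (suc b)) n
        ≡⟨ cong₂ _+_ (shift-zeroₛ k n) (lagSum-cong m (mono≗shift-one (suc b)) n) ⟩
      lagSum m (shift (suc b) one) n
        ≡⟨ lagSum-shift m (suc b) one n ⟩
      shift (suc b) (lagSum m one) n
        ∎

  count-shifted-≤ : ∀ {a} → a ≤ k → Count.count-shifted a k ≗ zeroₛ
  count-shifted-≤ {a} a≤k n with m≤n⇒m<n∨m≡n a≤k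
  ... | inj₁ a<k = occ-map-+-≡0 k no-hit (word 0 n)
    where
    open Count a k
    no-hit : ∀ u v → hit (k + u) (k + v) ≡ 0
    no-hit u v = trans (hit≡mono*mono (k + u) (k + v))
                       (cong (_* mono k (k + v)) (mono-≢ (<⇒≢ (≤-trans a<k (m≤m+n k u)))))
  ... | inj₂ refl = begin
    Count.count-shifted k k n               ≡⟨ cong (λ j → Count.count-shifted j j n) (+-identityʳ k) ⟨
    Count.count-shifted (k + 0) (k + 0) n   ≡⟨ count-shifted-+ 0 0 n ⟩
    Count.count 0 0 n                       ≡⟨ count[0,0]≗0 n ⟩
    0                                       ∎

  shift-count-shifted[a,k] : ∀ a → shift k (Count.count-shifted a k) ≗ shift a (iverson>ₛ a k (G t))
  shift-count-shifted[a,k] a n with a ≤? k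
  ... | yes a≤k = begin
    shift k (Count.count-shifted a k) n   ≡⟨ shift-cong k (count-shifted-≤ a≤k) n ⟩
    shift k zeroₛ n                       ≡⟨ shift-zeroₛ k n ⟩
    0                                     ≡⟨ shift-zeroₛ a n ⟨
    shift a zeroₛ n                       ≡⟨ cong (λ f → shift a f n) (iverson>-false (G t) a≤k) ⟨
    shift a (iverson>ₛ a k (G t)) n       ∎
  ... | no a≰k with m≤n⇒∃[o]m+o≡n (≰⇒> a≰k)
  ...   | b , refl = begin
    shift k (Count.count-shifted (suc k + b) k) n
      ≡⟨ shift-cong k rebracket n ⟨
    shift k (Count.count-shifted (k + suc b) (k + 0)) n
      ≡⟨ shift-cong k (λ n → trans (count-shifted-+ (suc b) 0 n) (count[1+b,0] b n)) n ⟩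
    shift k (shift (suc b) (G t)) n
      ≡⟨ shift-+ k (suc b) (G t) n ⟨
    shift (k + suc b) (G t) n
      ≡⟨ cong (λ s → shift s (G t) n) (+-suc k b) ⟩
    shift (suc k + b) (G t) n
      ≡⟨ cong (λ f → shift (suc k + b) f n) (iverson>-true (G t) (m≤m+n (suc k) b)) ⟨
    shift (suc k + b) (iverson>ₛ (suc k + b) k (G t)) n
      ∎
    where
    rebracket : Count.count-shifted (k + suc b) (k + 0) ≗ Count.count-shifted (suc k + b) k
    rebracket n = cong₂ (λ p q → Count.count-shifted p q n) (+-suc k b) (+-identityʳ k)

  recurrence-count[k+p,k+q] : ∀ p q → q ≢ 0 →
    Recurrence t (Count.count (k + p) (k + q)) (shift k (Count.count p q))
  recurrence-count[k+p,k+q] p q q≢0 = recurrence-resp {t} forcing recurrence-count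
    where
    open Count (k + p) (k + q)
    k+q≢k : k + q ≢ k
    k+q≢k k+q≡k = q≢0 (+-cancelˡ-≡ k q 0 (trans k+q≡k (sym (+-identityʳ k))))
    no-hit : ∀ {δ} → δ < t → ∀ n → hit n (start δ n) ≡ 0
    no-hit {δ}     _ zero    = hit≡mono*mono 0 (start δ 0)
    no-hit {zero}  _ (suc n) = begin
      hit (suc n) k                        ≡⟨ hit≡mono*mono (suc n) k ⟩
      mono (k + p) (suc n) * mono (k + q) k  ≡⟨ cong (mono (k + p) (suc n) *_) (mono-≢ k+q≢k) ⟩
      mono (k + p) (suc n) * 0             ≡⟨ *-zeroʳ (mono (k + p) (suc n)) ⟩
      0                                    ∎
    no-hit {suc δ} _ (suc n) =
      trans (hit≡mono*mono (suc n) 0) (*-zeroʳ (mono (k + p) (suc n)))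
    forcing : (shift k count-shifted ⊕ₛ junction t) ≗ shift k (Count.count p q)
    forcing n = begin
      shift k count-shifted n + junction t n
        ≡⟨ cong₂ _+_ (shift-cong k (count-shifted-+ p q) n) (junction-≡0 t no-hit n) ⟩
      shift k (Count.count p q) n + 0
        ≡⟨ +-identityʳ _ ⟩
      shift k (Count.count p q) n
        ∎

  module _ (a : ℕ) where

    last-factor : PS
    last-factor = mono t ⊕ₛ iverson>ₛ a k (G t)

    series : ℕ → PS
    series i = (H k ^ₛ i) ⊛ last-factor

    recurrence-series : ∀ s i → Recurrence t (shift s (series (suc i))) (shift s (series i))
    recurrence-series s i =
      recurrence-shift {t} s (recurrence-⊛ {t} last-factor (recurrence-H-power k i))

    recurrence-count[a,k] : 1 ≤ a → Recurrence t (Count.count a k) (shift a last-factor)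
    recurrence-count[a,k] a≥1 = recurrence-resp {t} forcing recurrence-count
      where
      open Count a k
      forcing : (shift k count-shifted ⊕ₛ junction t) ≗ shift a last-factor
      forcing n = begin
        shift k count-shifted n + junction t n
          ≡⟨ cong₂ _+_ (shift-count-shifted[a,k] a n) (junction-top a≥1 refl m n) ⟩
        shifted-G + mono (t + a) n
          ≡⟨ +-comm shifted-G (mono (t + a) n) ⟩
        mono (t + a) n + shifted-G
          ≡⟨ cong (λ s → mono s n + shifted-G) (+-comm t a) ⟩
        mono (a + t) n + shifted-G
          ≡⟨ cong (_+ shifted-G) (shift-mono a t n) ⟨
        shift a (mono t) n + shifted-G
          ≡⟨ shift-⊕ a (mono t) (iverson>ₛ a k (G t)) n ⟨
        shift a last-factor n
          ∎
        where shifted-G = shift a (iverson>ₛ a k (G t)) n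

    count[ki+a,ki+k] : 1 ≤ a → ∀ i →
      Count.count (k * i + a) (k * i + k) ≗ shift (a + k * i) (series (suc i))
    count[ki+a,ki+k] a≥1 zero n = begin
      Count.count (k * 0 + a) (k * 0 + k) n
        ≡⟨ cong (λ o → Count.count (o + a) (o + k) n) (*-zeroʳ k) ⟩
      Count.count a k n
        ≡⟨ recurrence-unique {t} (recurrence-count[a,k] a≥1) (recurrence-series a 0)
             (shift-cong a (sym ∘ ⊛-identityˡ last-factor)) n ⟩
      shift a (series 1) n
        ≡⟨ cong (λ s → shift s (series 1) n) (trans (cong (a +_) (*-zeroʳ k)) (+-identityʳ a)) ⟨
      shift (a + k * 0) (series 1) n
        ∎
    count[ki+a,ki+k] a≥1 (suc i) n = begin
      Count.count (k * suc i + a) (k * suc i + k) n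
        ≡⟨ cong₂ (λ p q → Count.count p q n) (k*suc-i+ a) (k*suc-i+ k) ⟩
      Count.count (k + (k * i + a)) (k + (k * i + k)) n
        ≡⟨ recurrence-unique {t} (recurrence-count[k+p,k+q] (k * i + a) (k * i + k) (m+1+n≢0 (k * i)))
             (recurrence-series (a + k * suc i) (suc i)) forcing n ⟩
      shift (a + k * suc i) (series (suc (suc i))) n
        ∎
      where
      k*suc-i+ : ∀ x → k * suc i + x ≡ k + (k * i + x)
      k*suc-i+ x = trans (cong (_+ x) (*-suc k i)) (+-assoc k (k * i) x)
      offset-suc : k + (a + k * i) ≡ a + k * suc i
      offset-suc = solve 3 (λ a k i → k :+ (a :+ k :* i) := a :+ k :* (con 1 :+ i)) refl a k i
        where open +-*-Solver
      forcing : shift k (Count.count (k * i + a) (k * i + k)) ≗ shift (a + k * suc i) (series (suc i))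
      forcing n = begin
        shift k (Count.count (k * i + a) (k * i + k)) n
          ≡⟨ shift-cong k (count[ki+a,ki+k] a≥1 i) n ⟩
        shift k (shift (a + k * i) (series (suc i))) n
          ≡⟨ shift-+ k (a + k * i) (series (suc i)) n ⟨
        shift (k + (a + k * i)) (series (suc i)) n
          ≡⟨ cong (λ s → shift s (series (suc i)) n) offset-suc ⟩
        shift (a + k * suc i) (series (suc i)) n
          ∎

theorem5p11 : (k : ℕ) → (hk : 3 ≤ k) → (a : ℕ) → 1 ≤ a → (i : ℕ) → (n : ℕ) →
    c k ((k * i + a) ∷ (k * i + k) ∷ []) n
      ≡ ((mono (a + k * i) ⊛ (H k ^ₛ (1 + i))) ⊛ (mono (k ∸ 1) ⊕ₛ iverson>ₛ a k (G (k ∸ 1)))) n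
theorem5p11 k@(suc (suc (suc m))) (s≤s (s≤s (s≤s _))) a a≥1 i n = begin
  c k (k * i + a ∷ k * i + k ∷ []) n
    ≡⟨ cong (occ (k * i + a ∷ k * i + k ∷ [])) (W≡word0 (suc m) n) ⟩
  Count.count (suc m) (k * i + a) (k * i + k) n
    ≡⟨ count[ki+a,ki+k] (suc m) a a≥1 i n ⟩
  shift (a + k * i) ((H k ^ₛ suc i) ⊛ F) n
    ≡⟨ shift-⊛ (a + k * i) (H k ^ₛ suc i) F n ⟨
  (shift (a + k * i) (H k ^ₛ suc i) ⊛ F) n
    ≡⟨ ⊛-congˡ F (mono-⊛ (a + k * i) (H k ^ₛ suc i)) n ⟨
  ((mono (a + k * i) ⊛ (H k ^ₛ suc i)) ⊛ F) n
    ∎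
  where F = last-factor (suc m) a
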